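{- Let $T$ be a regular tournament of order $2k+1$ (every vertex has in-degree and out-degree $k$). Then $\Delta(T)=k$. Furthermore, for any ordering $\sigma$ of $V(T)$, if $u$ and $v$ denote respectively the first and last vertices of $\sigma$, then $d_\sigma(u)=d_\sigma(v)=k$.
   Context: A tournament is a digraph with exactly one arc between each pair of distinct vertices. Given an ordering $\sigma = \langle v_1,\dots,v_n\rangle$ of $V(T)$, an arc $(v_i,v_j)$ is backward if $j<i$. For a vertex $v$, $d_\sigma(v)$ is the number of backward arcs of $\sigma$ incident to $v$; $\Delta_\sigma(T)=\max_{v} d_\sigma(v)$; the degreewidth of $T$ is $\Delta(T)=\min_\sigma \Delta_\sigma(T)$ over all orderings $\sigma$ of $V(T)$. -}

module Defs where

open import Data.Bool using (Bool; true; false; not; if_then_else_; _∧_; _∨_)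
open import Data.Nat using (ℕ; zero; suc; _+_; _⊔_; _≤_; _<ᵇ_)
open import Data.Fin using (Fin; toℕ)
open import Data.List using (List; foldr; map)
open import Data.List using () renaming (allFin to allFinL)
open import Data.Fin.Permutation using (Permutation′; _⟨$⟩ʳ_)
open import Data.Product using (Σ; _×_)
open import Relation.Binary.PropositionalEquality using (_≡_; _≢_)

record Tournament (n : ℕ) : Set where
  field
    arc        : Fin n → Fin n → Bool
    irreflexive : ∀ i → arc i i ≡ false
    exactlyOne : ∀ i j → i ≢ j → arc i j ≡ not (arc j i)
open Tournament public

count : {n : ℕ} → (Fin n → Bool) → ℕ
count {n} P = foldr (λ b acc → (if b then 1 else 0) + acc) 0 (map P (allFinL n))

-- maximum of a function over Fin n (0 if n = 0)
maxFin : {n : ℕ} → (Fin n → ℕ) → ℕ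
maxFin {n} f = foldr _⊔_ 0 (map f (allFinL n))

outDeg inDeg : {n : ℕ} → Tournament n → Fin n → ℕ
outDeg T v = count (λ w → arc T v w)
inDeg  T v = count (λ w → arc T w v)

Regular : {n : ℕ} → ℕ → Tournament n → Set
Regular k T = ∀ v → (outDeg T v ≡ k) × (inDeg T v ≡ k)

-- An ordering σ = ⟨v_1,…,v_n⟩: σ ⟨$⟩ʳ p is the vertex at position p.
Ordering : ℕ → Set
Ordering n = Permutation′ n

backwardPos : {n : ℕ} → Tournament n → Ordering n → Fin n → Fin n → Bool
backwardPos T σ p q = (toℕ q <ᵇ toℕ p) ∧ arc T (σ ⟨$⟩ʳ p) (σ ⟨$⟩ʳ q)

dPos : {n : ℕ} → Tournament n → Ordering n → Fin n → ℕ
dPos T σ p = count (λ q → backwardPos T σ p q ∨ backwardPos T σ q p)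

-- Δ_σ(T) = max over vertices (equivalently, over positions) of d_σ
Δσ : {n : ℕ} → Tournament n → Ordering n → ℕ
Δσ T σ = maxFin (dPos T σ)

DegreewidthIs : {n : ℕ} → Tournament n → ℕ → Set
DegreewidthIs T w = Σ (Ordering _) (λ σ → Δσ T σ ≡ w) × (∀ σ → w ≤ Δσ T σ)

-- Placing a vertex v first makes exactly its in-neighbours backward, so moving a
-- vertex whose backward degree exceeds its in-degree to the front strictly
-- decreases the total number of backward arcs. Iterating, some ordering has every
-- backward degree at most the maximal in-degree, which is k for a regular tournament.
-- Conversely, the first vertex of any ordering has backward degree equal to its
-- in-degree and the last one equal to its out-degree, both k; so Δ(T) = k.
module Submission where

open import Defs
open import Data.Nat using (ℕ; suc; _+_; _*_)
open import Data.Fin using (Fin; toℕ)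
open import Data.Product using (_×_)
open import Data.Sum using (_⊎_)
open import Relation.Binary.PropositionalEquality using (_≡_)

open import Data.Bool using (Bool; true; false; if_then_else_; _∧_; _∨_)
open import Data.Bool.Properties using (∧-zeroʳ)
open import Data.Fin using (zero; suc; punchIn)
open import Data.Fin.Permutation using (_⟨$⟩ʳ_; insert; insert-punchIn; _∘ₚ_)
  renaming (id to idₚ)
open import Data.Fin.Properties using (toℕ-injective; toℕ<n; all?; ¬∀⟶∃¬)
open import Data.List using (foldr; tabulate)
open import Data.List.Properties using (map-tabulate)
open import Data.Nat using (zero; _≤_; _<_; _⊔_; _<ᵇ_; z≤n; s≤s; _≤?_)
open import Data.Nat.Induction using (<-wellFounded)
open import Data.Nat.Properties
open import Data.Nat.Solver using (module +-*-Solver)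
open import Data.Product using (Σ; _,_; proj₁; proj₂)
open import Data.Sum using (inj₁; inj₂)
open import Induction.WellFounded using (Acc; acc)
open import Relation.Nullary using (yes; no)
open import Relation.Nullary.Negation using (contradiction)
open import Relation.Binary.PropositionalEquality
  using (refl; sym; trans; cong; cong₂; subst; module ≡-Reasoning)

open import Algebra.Properties.CommutativeMonoid.Sum +-0-commutativeMonoid
  using (sum-syntax; sum-cong-≗; sum-replicate-zero; sum-remove; ∑-distrib-+; ∑-permute)

indicator : Bool → ℕ
indicator b = if b then 1 else 0

count≡∑ : {n : ℕ} (P : Fin n → Bool) → count P ≡ ∑[ i < n ] indicator (P i)
count≡∑ P rewrite map-tabulate (λ i → i) P = foldr-tabulate P
  where
  foldr-tabulate : {n : ℕ} (P : Fin n → Bool) →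
    foldr (λ b acc → indicator b + acc) 0 (tabulate P) ≡ ∑[ i < n ] indicator (P i)
  foldr-tabulate {zero}  P = refl
  foldr-tabulate {suc n} P = cong (indicator (P zero) +_) (foldr-tabulate (λ i → P (suc i)))

∑≡0 : {n : ℕ} (f : Fin n → ℕ) → (∀ i → f i ≡ 0) → ∑[ i < n ] f i ≡ 0
∑≡0 {n} f f≡0 = trans (sum-cong-≗ f≡0) (sum-replicate-zero n)

≤-maxFin : {n : ℕ} (f : Fin n → ℕ) (i : Fin n) → f i ≤ maxFin f
≤-maxFin f i rewrite map-tabulate (λ j → j) f = ≤-foldr-⊔ f i
  where
  ≤-foldr-⊔ : {n : ℕ} (f : Fin n → ℕ) (i : Fin n) → f i ≤ foldr _⊔_ 0 (tabulate f)
  ≤-foldr-⊔ f zero    = m≤m⊔n _ _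
  ≤-foldr-⊔ f (suc i) = m≤n⇒m≤o⊔n (f zero) (≤-foldr-⊔ (λ j → f (suc j)) i)

maxFin-lub : {n : ℕ} (f : Fin n → ℕ) {k : ℕ} → (∀ i → f i ≤ k) → maxFin f ≤ k
maxFin-lub f f≤k rewrite map-tabulate (λ j → j) f = foldr-⊔-lub f f≤k
  where
  foldr-⊔-lub : {n : ℕ} (f : Fin n → ℕ) {k : ℕ} → (∀ i → f i ≤ k) → foldr _⊔_ 0 (tabulate f) ≤ k
  foldr-⊔-lub {zero}  f f≤k = z≤n
  foldr-⊔-lub {suc n} f f≤k = ⊔-lub (f≤k zero) (foldr-⊔-lub (λ i → f (suc i)) (λ i → f≤k (suc i)))

<ᵇ≡false : ∀ {m n} → n ≤ m → (m <ᵇ n) ≡ false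
<ᵇ≡false {zero}  z≤n     = refl
<ᵇ≡false {suc m} z≤n     = refl
<ᵇ≡false         (s≤s p) = <ᵇ≡false p

<ᵇ≡true : ∀ {m n} → m < n → (m <ᵇ n) ≡ true
<ᵇ≡true {zero}  (s≤s p) = refl
<ᵇ≡true {suc m} (s≤s p) = <ᵇ≡true p

indicator-<ᵇ-∧ : ∀ {m n} (x : Bool) → m ≤ n → (m ≡ n → x ≡ false) →
  indicator ((m <ᵇ n) ∧ x) ≡ indicator x
indicator-<ᵇ-∧ {m} {n} x m≤n m≡n⇒¬x with m ≟ n
... | yes m≡n rewrite m≡n⇒¬x m≡n | ∧-zeroʳ (m <ᵇ n) = refl
... | no  m≢n rewrite <ᵇ≡true (≤∧≢⇒< m≤n m≢n) = refl

indicator-∨-opposite : ∀ m n (x y : Bool) →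
  indicator (((m <ᵇ n) ∧ x) ∨ ((n <ᵇ m) ∧ y)) ≡ indicator ((m <ᵇ n) ∧ x) + indicator ((n <ᵇ m) ∧ y)
indicator-∨-opposite zero    zero    x     y     = refl
indicator-∨-opposite zero    (suc n) false y     = refl
indicator-∨-opposite zero    (suc n) true  y     = refl
indicator-∨-opposite (suc m) zero    x     false = refl
indicator-∨-opposite (suc m) zero    x     true  = refl
indicator-∨-opposite (suc m) (suc n) x     y     = indicator-∨-opposite m n x y

punchIn-<ᵇ : ∀ {m} (i : Fin (suc m)) (p q : Fin m) →
  (toℕ (punchIn i q) <ᵇ toℕ (punchIn i p)) ≡ (toℕ q <ᵇ toℕ p)
punchIn-<ᵇ zero    p       q       = refl
punchIn-<ᵇ (suc i) zero    zero    = refl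
punchIn-<ᵇ (suc i) (suc p) zero    = refl
punchIn-<ᵇ (suc i) zero    (suc q) = refl
punchIn-<ᵇ (suc i) (suc p) (suc q) = punchIn-<ᵇ i p q

module _ {n : ℕ} (T : Tournament n) where

  backward : Ordering n → Fin n → Fin n → ℕ
  backward σ p q = indicator (backwardPos T σ p q)

  backwardOut backwardIn : Ordering n → Fin n → ℕ
  backwardOut σ p = ∑[ q < n ] backward σ p q
  backwardIn  σ p = ∑[ q < n ] backward σ q p

  backwardArcs : Ordering n → ℕ
  backwardArcs σ = ∑[ p < n ] backwardOut σ p

  dPos≡backwardOut+backwardIn : (σ : Ordering n) (p : Fin n) →
    dPos T σ p ≡ backwardOut σ p + backwardIn σ p
  dPos≡backwardOut+backwardIn σ p = begin
    dPos T σ p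
      ≡⟨ count≡∑ (λ q → backwardPos T σ p q ∨ backwardPos T σ q p) ⟩
    ∑[ q < n ] indicator (backwardPos T σ p q ∨ backwardPos T σ q p)
      ≡⟨ sum-cong-≗ (λ q → indicator-∨-opposite (toℕ q) (toℕ p)
                             (arc T (σ ⟨$⟩ʳ p) (σ ⟨$⟩ʳ q)) (arc T (σ ⟨$⟩ʳ q) (σ ⟨$⟩ʳ p))) ⟩
    ∑[ q < n ] (backward σ p q + backward σ q p)
      ≡⟨ ∑-distrib-+ (backward σ p) (λ q → backward σ q p) ⟩
    backwardOut σ p + backwardIn σ p ∎
    where open ≡-Reasoning

  inDeg-ordered : (σ : Ordering n) (v : Fin n) → inDeg T v ≡ ∑[ q < n ] indicator (arc T (σ ⟨$⟩ʳ q) v)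
  inDeg-ordered σ v = trans (count≡∑ (λ w → arc T w v)) (∑-permute (λ w → indicator (arc T w v)) σ)

  outDeg-ordered : (σ : Ordering n) (v : Fin n) → outDeg T v ≡ ∑[ q < n ] indicator (arc T v (σ ⟨$⟩ʳ q))
  outDeg-ordered σ v = trans (count≡∑ (arc T v)) (∑-permute (λ w → indicator (arc T v w)) σ)

  backward-≡0 : (σ : Ordering n) {p q : Fin n} → toℕ p ≤ toℕ q → backward σ p q ≡ 0
  backward-≡0 σ p≤q rewrite <ᵇ≡false p≤q = refl

  arc-samePos : (σ : Ordering n) {p q : Fin n} → toℕ p ≡ toℕ q → arc T (σ ⟨$⟩ʳ p) (σ ⟨$⟩ʳ q) ≡ false
  arc-samePos σ p≡q rewrite toℕ-injective p≡q = irreflexive T _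

  backwardOut-first : (σ : Ordering n) (p : Fin n) → toℕ p ≡ 0 → backwardOut σ p ≡ 0
  backwardOut-first σ p p≡0 = ∑≡0 (backward σ p) (λ q → backward-≡0 σ (subst (_≤ toℕ q) (sym p≡0) z≤n))

  dPos-first : (σ : Ordering n) (p : Fin n) → toℕ p ≡ 0 → dPos T σ p ≡ inDeg T (σ ⟨$⟩ʳ p)
  dPos-first σ p p≡0 = begin
    dPos T σ p                        ≡⟨ dPos≡backwardOut+backwardIn σ p ⟩
    backwardOut σ p + backwardIn σ p  ≡⟨ cong (_+ backwardIn σ p) (backwardOut-first σ p p≡0) ⟩
    backwardIn σ p                    ≡⟨ sum-cong-≗ (λ q → indicator-<ᵇ-∧ _ (p≤q q) (λ p≡q → arc-samePos σ (sym p≡q))) ⟩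
    ∑[ q < n ] indicator (arc T (σ ⟨$⟩ʳ q) (σ ⟨$⟩ʳ p)) ≡⟨ inDeg-ordered σ _ ⟨
    inDeg T (σ ⟨$⟩ʳ p)                ∎
    where
    open ≡-Reasoning
    p≤q : ∀ q → toℕ p ≤ toℕ q
    p≤q q = subst (_≤ toℕ q) (sym p≡0) z≤n

  dPos-last : (σ : Ordering n) (p : Fin n) → suc (toℕ p) ≡ n → dPos T σ p ≡ outDeg T (σ ⟨$⟩ʳ p)
  dPos-last σ p p≡n-1 = begin
    dPos T σ p                        ≡⟨ dPos≡backwardOut+backwardIn σ p ⟩
    backwardOut σ p + backwardIn σ p  ≡⟨ cong (backwardOut σ p +_) backwardIn-last ⟩
    backwardOut σ p + 0               ≡⟨ +-identityʳ _ ⟩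
    backwardOut σ p                   ≡⟨ sum-cong-≗ (λ q → indicator-<ᵇ-∧ _ (q≤p q) (λ q≡p → arc-samePos σ (sym q≡p))) ⟩
    ∑[ q < n ] indicator (arc T (σ ⟨$⟩ʳ p) (σ ⟨$⟩ʳ q)) ≡⟨ outDeg-ordered σ _ ⟨
    outDeg T (σ ⟨$⟩ʳ p)               ∎
    where
    open ≡-Reasoning
    q≤p : ∀ q → toℕ q ≤ toℕ p
    q≤p q = ≤-pred (subst (toℕ q <_) (sym p≡n-1) (toℕ<n q))
    backwardIn-last : backwardIn σ p ≡ 0
    backwardIn-last = ∑≡0 (λ q → backward σ q p) (λ q → backward-≡0 σ (q≤p q))

moveToFront : {m : ℕ} → Fin (suc m) → Ordering (suc m) → Ordering (suc m)
moveToFront i σ = insert zero i idₚ ∘ₚ σ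

moveToFront-suc : {m : ℕ} (i : Fin (suc m)) (σ : Ordering (suc m)) (p : Fin m) →
  moveToFront i σ ⟨$⟩ʳ suc p ≡ σ ⟨$⟩ʳ punchIn i p
moveToFront-suc i σ p = cong (σ ⟨$⟩ʳ_) (insert-punchIn zero i idₚ p)

module _ {m : ℕ} (T : Tournament (suc m)) where

  backwardArcs-moveToFront : (σ : Ordering (suc m)) (i : Fin (suc m)) →
    backwardArcs T (moveToFront i σ) + dPos T σ i ≡ backwardArcs T σ + inDeg T (σ ⟨$⟩ʳ i)
  backwardArcs-moveToFront σ i = begin
    backwardArcs T σ′ + dPos T σ i         ≡⟨ cong₂ _+_ arcs-after dPos-before ⟩
    (inArcs + rest) + (out + into)         ≡⟨ solve 4 (λ a r o t → (a :+ r) :+ (o :+ t) := (o :+ (t :+ r)) :+ a)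
                                                     refl inArcs rest out into ⟩
    (out + (into + rest)) + inArcs         ≡⟨ cong₂ _+_ arcs-before inDeg-before ⟨
    backwardArcs T σ + inDeg T (σ ⟨$⟩ʳ i)  ∎
    where
    open ≡-Reasoning
    open +-*-Solver using (solve; _:+_; _:=_)
    σ′ : Ordering (suc m)
    σ′ = moveToFront i σ
    out into rest inArcs : ℕ
    out = backwardOut T σ i
    rest = ∑[ p < m ] ∑[ q < m ] backward T σ (punchIn i p) (punchIn i q)
    into = ∑[ p < m ] backward T σ (punchIn i p) i
    inArcs = ∑[ p < m ] indicator (arc T (σ ⟨$⟩ʳ punchIn i p) (σ ⟨$⟩ʳ i))

    arcs-before : backwardArcs T σ ≡ out + (into + rest)
    arcs-before = trans (sum-remove {i = i} (backwardOut T σ))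
      (cong (out +_)
        (trans (sum-cong-≗ (λ p → sum-remove {i = i} (backward T σ (punchIn i p))))
               (∑-distrib-+ (λ p → backward T σ (punchIn i p) i) _)))

    dPos-before : dPos T σ i ≡ out + into
    dPos-before = trans (dPos≡backwardOut+backwardIn T σ i)
      (cong (out +_)
        (trans (sum-remove {i = i} (λ q → backward T σ q i))
               (cong (_+ into) (backward-≡0 T σ ≤-refl))))

    arcs-after : backwardArcs T σ′ ≡ inArcs + rest
    arcs-after = begin
      backwardOut T σ′ zero + ∑[ p < m ] (backward T σ′ (suc p) zero + ∑[ q < m ] backward T σ′ (suc p) (suc q))
        ≡⟨ cong (_+ ∑[ p < m ] backwardOut T σ′ (suc p)) (backwardOut-first T σ′ zero refl) ⟩
      ∑[ p < m ] (backward T σ′ (suc p) zero + ∑[ q < m ] backward T σ′ (suc p) (suc q))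
        ≡⟨ ∑-distrib-+ (λ p → backward T σ′ (suc p) zero) _ ⟩
      ∑[ p < m ] backward T σ′ (suc p) zero + ∑[ p < m ] ∑[ q < m ] backward T σ′ (suc p) (suc q)
        ≡⟨ cong₂ _+_ (sum-cong-≗ into-front) (sum-cong-≗ (λ p → sum-cong-≗ (behind-front p))) ⟩
      inArcs + rest ∎
      where
      into-front : ∀ p → backward T σ′ (suc p) zero ≡ indicator (arc T (σ ⟨$⟩ʳ punchIn i p) (σ ⟨$⟩ʳ i))
      into-front p rewrite moveToFront-suc i σ p = refl
      behind-front : ∀ p q → backward T σ′ (suc p) (suc q) ≡ backward T σ (punchIn i p) (punchIn i q)
      behind-front p q rewrite moveToFront-suc i σ p | moveToFront-suc i σ q | punchIn-<ᵇ i p q = refl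

    inDeg-before : inDeg T (σ ⟨$⟩ʳ i) ≡ inArcs
    inDeg-before = trans (inDeg-ordered T σ (σ ⟨$⟩ʳ i))
      (trans (sum-remove {i = i} (λ q → indicator (arc T (σ ⟨$⟩ʳ q) (σ ⟨$⟩ʳ i))))
             (cong (λ b → indicator b + inArcs) (irreflexive T (σ ⟨$⟩ʳ i))))

  moveToFront-decreasing : (σ : Ordering (suc m)) (i : Fin (suc m)) → inDeg T (σ ⟨$⟩ʳ i) < dPos T σ i →
    backwardArcs T (moveToFront i σ) < backwardArcs T σ
  moveToFront-decreasing σ i in<d = +-cancelʳ-< (dPos T σ i) _ _
    (subst (_< backwardArcs T σ + dPos T σ i) (sym (backwardArcs-moveToFront σ i))
      (+-monoʳ-< (backwardArcs T σ) in<d))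

  inDeg≤⇒∃ordering-dPos≤ : {k : ℕ} → (∀ v → inDeg T v ≤ k) →
    Σ (Ordering (suc m)) (λ σ → ∀ p → dPos T σ p ≤ k)
  inDeg≤⇒∃ordering-dPos≤ {k} inDeg≤k = improve idₚ (<-wellFounded _)
    where
    improve : (σ : Ordering (suc m)) → Acc _<_ (backwardArcs T σ) →
      Σ (Ordering (suc m)) (λ σ → ∀ p → dPos T σ p ≤ k)
    improve σ (acc smaller) with all? (λ p → dPos T σ p ≤? k)
    ... | yes dPos≤k = σ , dPos≤k
    ... | no ¬dPos≤k with ¬∀⟶∃¬ _ _ (λ p → dPos T σ p ≤? k) ¬dPos≤k
    ... | i , dPos≰k = improve (moveToFront i σ)
      (smaller (moveToFront-decreasing σ i (≤-<-trans (inDeg≤k (σ ⟨$⟩ʳ i)) (≰⇒> dPos≰k))))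

mainTheorem2 : (k n : ℕ) → n ≡ 2 * k + 1 → (T : Tournament n) → Regular k T →
    DegreewidthIs T k ×
    ((σ : Ordering n) → (p : Fin n) → (toℕ p ≡ 0 ⊎ suc (toℕ p) ≡ n) → dPos T σ p ≡ k)
-- Regularity alone forces n = 2k + 1; the order hypothesis is only needed to exclude n = 0.
mainTheorem2 k zero    n≡2k+1 T regular = contradiction (sym n≡2k+1) (m+1+n≢0 (2 * k))
mainTheorem2 k (suc m) _      T regular = ((σ , ≤-antisym Δσ≤k (k≤Δσ σ)) , k≤Δσ) , dPos-ends
  where
  dPos-ends : (σ : Ordering (suc m)) (p : Fin (suc m)) → toℕ p ≡ 0 ⊎ suc (toℕ p) ≡ suc m → dPos T σ p ≡ k
  dPos-ends σ p (inj₁ first) = trans (dPos-first T σ p first) (proj₂ (regular _))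
  dPos-ends σ p (inj₂ last)  = trans (dPos-last T σ p last) (proj₁ (regular _))

  k≤Δσ : ∀ σ → k ≤ Δσ T σ
  k≤Δσ σ = subst (_≤ Δσ T σ) (dPos-ends σ zero (inj₁ refl)) (≤-maxFin (dPos T σ) zero)

  optimal : Σ (Ordering (suc m)) (λ σ → ∀ p → dPos T σ p ≤ k)
  optimal = inDeg≤⇒∃ordering-dPos≤ T (λ v → ≤-reflexive (proj₂ (regular v)))
  σ : Ordering (suc m)
  σ = proj₁ optimal

  Δσ≤k : Δσ T σ ≤ k
  Δσ≤k = maxFin-lub (dPos T σ) (proj₂ optimal)
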